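{- Let $\theta(n)$ be an integer-valued function of $n$ with $1\leq\theta(n)\leq n$. Then for every undirected simple graph $G$ on $n$ vertices, the number of even induced subgraphs of $G$ whose order lies in the interval $[\theta(n)/2,\theta(n)]$ is at least $$\binom{n}{n-\theta(n)}\Big/\binom{n-\frac{1}{2}\theta(n)}{n-\theta(n)}.$$
   Context: An induced subgraph is even if every vertex has even degree in it; induced subgraphs are counted as vertex subsets. The binomial coefficient $\binom{x}{m}$ with possibly non-integer $x$ denotes $x(x-1)\cdots(x-m+1)/m!$. -}

module Defs where

open import Data.Bool using (Bool; true; false)
open import Data.Nat as ℕ using (ℕ; zero; suc; _≤_; _∸_; _!)
open import Data.Nat.Properties using (_!≢0; _≤?_)
open import Data.Nat.Divisibility using (_∣_; _∣?_)
open import Data.Nat.Combinatorics using (_C_)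
open import Data.Fin using (Fin)
open import Data.Fin.Subset using (Subset; _∈_; _∩_; ∣_∣)
open import Data.Fin.Subset.Properties using (_∈?_)
open import Data.Fin.Properties using (all?)
open import Data.Vec using (Vec; []; _∷_; tabulate)
open import Data.List using (List; []; _∷_; map; _++_; length; filter)
open import Data.Product using (_×_)
open import Data.Integer as ℤ using (ℤ; +_)
open import Data.Rational as ℚ using (ℚ; _/_; _*_; _-_; 1ℚ)
open import Relation.Nullary using (Dec; ¬_)
open import Relation.Nullary.Decidable using (_→-dec_; _×-dec_)
open import Relation.Binary.PropositionalEquality using (_≡_)

record SimpleGraph (n : ℕ) : Set where
  field
    adj   : Fin n → Fin n → Bool
    sym   : ∀ u v → adj u v ≡ adj v u
    loopless : ∀ v → adj v v ≡ false
open SimpleGraph public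

nbhd : ∀ {n} → SimpleGraph n → Fin n → Subset n
nbhd G v = tabulate (adj G v)

degIn : ∀ {n} → SimpleGraph n → Subset n → Fin n → ℕ
degIn G S v = ∣ S ∩ nbhd G v ∣

IsEvenInduced : ∀ {n} → SimpleGraph n → Subset n → Set
IsEvenInduced G S = ∀ v → v ∈ S → 2 ∣ degIn G S v

isEvenInduced? : ∀ {n} (G : SimpleGraph n) (S : Subset n) → Dec (IsEvenInduced G S)
isEvenInduced? G S = all? (λ v → (v ∈? S) →-dec (2 ∣? degIn G S v))

allSubsets : ∀ n → List (Subset n)
allSubsets zero = [] ∷ []
allSubsets (suc n) = map (true ∷_) (allSubsets n) ++ map (false ∷_) (allSubsets n)

-- θ/2 ≤ |S| ≤ θ  (the first written as θ ≤ 2|S|, all in ℕ).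
InRange : ∀ {n} → ℕ → Subset n → Set
InRange θ S = (θ ≤ 2 ℕ.* ∣ S ∣) × (∣ S ∣ ≤ θ)

countEvenInRange : ∀ {n} → SimpleGraph n → ℕ → ℕ
countEvenInRange {n} G θ =
  length (filter (λ S → (θ ≤? 2 ℕ.* ∣ S ∣ ×-dec ∣ S ∣ ≤? θ) ×-dec isEvenInduced? G S)
                 (allSubsets n))

fallingQ : ℚ → ℕ → ℚ
fallingQ x zero = 1ℚ
fallingQ x (suc m) = fallingQ x m * (x - (+ m / 1))

binomQ : ℚ → ℕ → ℚ
binomQ x m = fallingQ x m * ((+ 1 / (m !)) {{m !≢0}})

toℚ : ℕ → ℚ
toℚ k = + k / 1

{-# OPTIONS --safe #-}
-- By Gallai's theorem the vertex set of every graph splits into two parts that both induce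
-- even subgraphs, so every θ-set T of vertices contains an even S with θ/2 ≤ |S| ≤ θ.
-- Double counting the pairs S ⊆ T with |T| = θ gives C(n, θ) ≤ Σ_S C(n − |S|, n − θ), the sum
-- running over the even S with θ/2 ≤ |S| ≤ θ, and each term is at most C(n − θ/2, n − θ)
-- because |S| ≥ θ/2.
-- Gallai's theorem is proved by induction on |T|: if some v ∈ T has odd degree in G[T],
-- split T ∖ v in the local complement of G at v and add v to the part containing an even
-- number of its neighbours; complementing N(v) is exactly what makes both parts even in G.
module Submission where

module Gallai where

  open import Algebra.Bundles using (CommutativeMonoid; CommutativeRing)
  open import Data.Bool using (Bool; true; false; not; _∧_; _xor_; if_then_else_)
  open import Data.Bool.Properties
    using (xor-∧-commutativeRing; xor-comm; xor-same; xor-assoc; xor-identityʳ;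
           ∧-zeroʳ; ∧-identityʳ; ∧-comm; ∧-idem; not-involutive; ¬-not; if-float)
    renaming (_≟_ to _≟ᵇ_)
  open import Data.Fin using (Fin; zero; suc)
  open import Data.Fin.Properties using (_≟_; any?)
  open import Data.Fin.Subset using (Subset; _∩_; ∁; ∣_∣; _⊆_)
  open import Data.Fin.Subset.Properties using (p∩q⊆p)
  open import Data.Nat using (ℕ; zero; suc; _+_; _*_; _≤_; _<_)
  open import Data.Nat.Divisibility using (_∣_; divides)
  open import Data.Nat.Induction using (<-wellFounded)
  open import Data.Nat.Properties
    using (n<1+n; +-comm; +-suc; +-identityʳ; ≤-total; +-monoˡ-≤; +-monoʳ-≤; +-0-commutativeMonoid)
  open import Data.Product using (Σ-syntax; ∃-syntax; _×_; _,_)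
  open import Data.Sum using (_⊎_; inj₁; inj₂)
  open import Data.Vec using ([]; _∷_; lookup; tabulate)
  open import Data.Vec.Functional using (updateAt)
  open import Data.Vec.Functional.Properties using (updateAt-updates; updateAt-minimal)
  open import Data.Vec.Properties using (lookup-zipWith; lookup∘tabulate; lookup-map; []=⇒lookup)
  open import Function using (_∘_)
  open import Induction.WellFounded using (Acc; acc)
  open import Level using (Level)
  open import Relation.Binary.PropositionalEquality
  open import Relation.Nullary using (does; yes; no; contradiction)
  open import Relation.Nullary.Decidable using (_×-dec_; dec-true; dec-false)

  open import Defs hiding (sym)

  module _ {c ℓ : Level} (M : CommutativeMonoid c ℓ) where
    open CommutativeMonoid M
      using (Carrier; _≈_; _∙_; ε; identityˡ; identityʳ; ∙-congˡ)
      renaming (trans to ≈-trans; sym to ≈-sym)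
    open import Algebra.Properties.CommutativeMonoid.Sum M using (sum; sum-cong-≋; ∑-distrib-+; sum-replicate-zero)

    sum-at : ∀ {n} (f : Fin n → Carrier) v → sum (λ w → if does (w ≟ v) then f w else ε) ≈ f v
    sum-at {suc n} f zero    = ≈-trans (∙-congˡ (sum-replicate-zero n)) (identityʳ _)
    sum-at {suc n} f (suc v) = ≈-trans (identityˡ _) (sum-at (f ∘ suc) v)

    sum-split-at : ∀ {n} (f : Fin n → Carrier) v →
                   sum f ≈ sum (λ w → if does (w ≟ v) then ε else f w) ∙ f v
    sum-split-at f v = ≈-trans (sum-cong-≋ (λ w → split (does (w ≟ v)) (f w)))
      (≈-trans (∑-distrib-+ (λ w → if does (w ≟ v) then ε else f w) (λ w → if does (w ≟ v) then f w else ε))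
               (∙-congˡ (sum-at f v)))
      where
      split : ∀ b x → x ≈ (if b then ε else x) ∙ (if b then x else ε)
      split true  x = ≈-sym (identityˡ x)
      split false x = ≈-sym (identityʳ x)

  open import Algebra.Properties.Semiring.Sum (CommutativeRing.semiring xor-∧-commutativeRing)
    using ()
    renaming (sum to parity; sum-cong-≗ to parity-cong; ∑-distrib-+ to parity-distrib-xor;
              *-distribˡ-sum to ∧-distribˡ-parity)
  open import Algebra.Properties.CommutativeMonoid.Sum +-0-commutativeMonoid
    using () renaming (sum to ∑ᶠ; sum-cong-≗ to ∑ᶠ-cong)

  xor-cancelʳ : ∀ {a b c} → a ≡ b xor c → b ≡ a xor c
  xor-cancelʳ {b = b} {c} refl = begin
    b                  ≡⟨ sym (xor-identityʳ b) ⟩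
    b xor false        ≡⟨ cong (b xor_) (sym (xor-same c)) ⟩
    b xor (c xor c)    ≡⟨ sym (xor-assoc b c c) ⟩
    (b xor c) xor c    ∎
    where open ≡-Reasoning

  𝟙 : Bool → ℕ
  𝟙 true  = 1
  𝟙 false = 0

  _∖_ : ∀ {n} → (Fin n → Bool) → Fin n → Fin n → Bool
  (X ∖ v) w = if does (w ≟ v) then false else X w

  parity-split-at : ∀ {n} (f : Fin n → Bool) v →
                    parity f ≡ parity (λ w → if does (w ≟ v) then false else f w) xor f v
  parity-split-at = sum-split-at (CommutativeRing.+-commutativeMonoid xor-∧-commutativeRing)

  size : ∀ {n} → (Fin n → Bool) → ℕ
  size X = ∑ᶠ (λ w → 𝟙 (X w))

  size-∖-< : ∀ {n} (X : Fin n → Bool) v → X v ≡ true → size (X ∖ v) < size X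
  size-∖-< X v Xv = subst (size (X ∖ v) <_) (sym size≡) (n<1+n _)
    where
    size≡ : size X ≡ suc (size (X ∖ v))
    size≡ = begin
      size X
        ≡⟨ sum-split-at +-0-commutativeMonoid (λ w → 𝟙 (X w)) v ⟩
      ∑ᶠ (λ w → if does (w ≟ v) then 0 else 𝟙 (X w)) + 𝟙 (X v)
        ≡⟨ cong₂ _+_ (∑ᶠ-cong (λ w → sym (if-float 𝟙 (does (w ≟ v))))) (cong 𝟙 Xv) ⟩
      size (X ∖ v) + 1
        ≡⟨ +-comm (size (X ∖ v)) 1 ⟩
      suc (size (X ∖ v)) ∎
      where open ≡-Reasoning

  module _ {n : ℕ} where

    oddDegree : SimpleGraph n → (Fin n → Bool) → Fin n → Bool
    oddDegree G X u = parity (λ w → X w ∧ adj G u w)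

    IsEven : SimpleGraph n → (Fin n → Bool) → Set
    IsEven G X = ∀ u → X u ≡ true → oddDegree G X u ≡ false

    oddDegree-cong : ∀ G {X Y} → X ≗ Y → ∀ u → oddDegree G X u ≡ oddDegree G Y u
    oddDegree-cong G X≗Y u = parity-cong (λ w → cong (_∧ adj G u w) (X≗Y w))

    IsEven-cong : ∀ G {X Y} → X ≗ Y → IsEven G X → IsEven G Y
    IsEven-cong G X≗Y even u Yu = trans (oddDegree-cong G (sym ∘ X≗Y) u) (even u (trans (X≗Y u) Yu))

    oddDegree-∖ : ∀ G X u v → oddDegree G X u ≡ oddDegree G (X ∖ v) u xor (X v ∧ adj G u v)
    oddDegree-∖ G X u v = trans (parity-split-at (λ w → X w ∧ adj G u w) v)
      (cong (_xor _) (parity-cong (λ w → sym (if-float (_∧ adj G u w) (does (w ≟ v))))))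

    oddDegree-partition : ∀ G X (c : Fin n → Bool) u →
      oddDegree G X u ≡ oddDegree G (λ w → X w ∧ c w) u xor oddDegree G (λ w → X w ∧ not (c w)) u
    oddDegree-partition G X c u = trans (parity-cong (λ w → split (X w) (c w) (adj G u w)))
      (parity-distrib-xor (λ w → (X w ∧ c w) ∧ adj G u w) (λ w → (X w ∧ not (c w)) ∧ adj G u w))
      where
      split : ∀ x c a → x ∧ a ≡ ((x ∧ c) ∧ a) xor ((x ∧ not c) ∧ a)
      split false c     a = refl
      split true  false a = refl
      split true  true  a = sym (xor-identityʳ a)

    does-≟-sym : ∀ (u w : Fin n) → does (u ≟ w) ≡ does (w ≟ u)
    does-≟-sym u w with u ≟ w
    ... | yes u≡w = sym (dec-true (w ≟ u) (sym u≡w))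
    ... | no  u≢w = sym (dec-false (w ≟ u) (u≢w ∘ sym))

    localComplement : SimpleGraph n → Fin n → SimpleGraph n
    localComplement G v = record
      { adj      = λ u w → if does (w ≟ u) then false else adj G u w xor (adj G v u ∧ adj G v w)
      ; sym      = λ u w → cong₂ (if_then false else_) (does-≟-sym w u)
                                   (cong₂ _xor_ (SimpleGraph.sym G u w) (∧-comm (adj G v u) (adj G v w)))
      ; loopless = λ u → cong (if_then false else _) (dec-true (u ≟ u) refl)
      }

    oddDegree-localComplement : ∀ G v X u → X u ≡ true →
      oddDegree (localComplement G v) X u ≡ oddDegree G X u xor (adj G v u ∧ not (oddDegree G X v))
    oddDegree-localComplement G v X u Xu = begin
        oddDegree (localComplement G v) X u
      ≡⟨ parity-cong (λ w → ∧-if (X w) (does (w ≟ u)) (g-summand w)) ⟩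
        parity (λ w → if does (w ≟ u) then false else g w)
      ≡⟨ xor-cancelʳ (parity-split-at g u) ⟩
        parity g xor g u
      ≡⟨ cong₂ _xor_ parity-g g-u ⟩
        (oddDegree G X u xor (b ∧ oddDegree G X v)) xor b
      ≡⟨ xor-assoc (oddDegree G X u) _ b ⟩
        oddDegree G X u xor ((b ∧ oddDegree G X v) xor b)
      ≡⟨ cong (oddDegree G X u xor_) (∧-xor-self b (oddDegree G X v)) ⟩
        oddDegree G X u xor (b ∧ not (oddDegree G X v)) ∎
      where
      open ≡-Reasoning
      b = adj G v u
      g-summand : Fin n → Bool
      g-summand w = adj G u w xor (b ∧ adj G v w)
      g : Fin n → Bool
      g w = X w ∧ g-summand w
      ∧-if : ∀ x e y → x ∧ (if e then false else y) ≡ (if e then false else x ∧ y)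
      ∧-if x true  y = ∧-zeroʳ x
      ∧-if x false y = refl
      ∧-xor-self : ∀ b d → (b ∧ d) xor b ≡ b ∧ not d
      ∧-xor-self false d     = refl
      ∧-xor-self true  false = refl
      ∧-xor-self true  true  = refl
      distrib : ∀ x p q → x ∧ (p xor (b ∧ q)) ≡ (x ∧ p) xor (b ∧ (x ∧ q))
      distrib true  p q = refl
      distrib false p q = sym (∧-zeroʳ b)
      parity-g : parity g ≡ oddDegree G X u xor (b ∧ oddDegree G X v)
      parity-g = begin
          parity g
        ≡⟨ parity-cong (λ w → distrib (X w) (adj G u w) (adj G v w)) ⟩
          parity (λ w → (X w ∧ adj G u w) xor (b ∧ (X w ∧ adj G v w)))
        ≡⟨ parity-distrib-xor (λ w → X w ∧ adj G u w) (λ w → b ∧ (X w ∧ adj G v w)) ⟩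
          oddDegree G X u xor parity (λ w → b ∧ (X w ∧ adj G v w))
        ≡⟨ cong (oddDegree G X u xor_) (sym (∧-distribˡ-parity b (λ w → X w ∧ adj G v w))) ⟩
          oddDegree G X u xor (b ∧ oddDegree G X v) ∎
      g-u : g u ≡ b
      g-u = trans (cong₂ (λ x l → x ∧ (l xor (b ∧ b))) Xu (loopless G u)) (∧-idem b)

    isEven-of-localComplement : ∀ G v X → IsEven (localComplement G v) (X ∖ v) →
                                oddDegree G (X ∖ v) v ≡ not (X v) → IsEven G X
    isEven-of-localComplement G v X even deg-v u Xu with u ≟ v
    ... | yes refl = begin
        oddDegree G X u                            ≡⟨ oddDegree-∖ G X u u ⟩
        oddDegree G (X ∖ u) u xor (X u ∧ adj G u u) ≡⟨ cong₂ _xor_ deg-v (cong₂ _∧_ Xu (loopless G u)) ⟩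
        not (X u) xor false                        ≡⟨ cong (λ x → not x xor false) Xu ⟩
        false                                      ∎
      where open ≡-Reasoning
    ... | no u≢v = begin
        oddDegree G X u
          ≡⟨ oddDegree-∖ G X u v ⟩
        oddDegree G (X ∖ v) u xor (X v ∧ adj G u v)
          ≡⟨ cong₂ _xor_ deg-u (∧-comm (X v) (adj G u v)) ⟩
        (adj G v u ∧ X v) xor (adj G u v ∧ X v)
          ≡⟨ cong (λ a → (adj G v u ∧ X v) xor (a ∧ X v)) (SimpleGraph.sym G u v) ⟩
        (adj G v u ∧ X v) xor (adj G v u ∧ X v)
          ≡⟨ xor-same (adj G v u ∧ X v) ⟩
        false ∎
      where
      open ≡-Reasoning
      u∈X∖v : (X ∖ v) u ≡ true
      u∈X∖v = trans (cong (if_then false else X u) (dec-false (u ≟ v) u≢v)) Xu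
      deg-u : oddDegree G (X ∖ v) u ≡ adj G v u ∧ X v
      deg-u = begin
        oddDegree G (X ∖ v) u
          ≡⟨ xor-cancelʳ (oddDegree-localComplement G v (X ∖ v) u u∈X∖v) ⟩
        oddDegree (localComplement G v) (X ∖ v) u xor (adj G v u ∧ not (oddDegree G (X ∖ v) v))
          ≡⟨ cong₂ (λ d e → d xor (adj G v u ∧ not e)) (even u u∈X∖v) deg-v ⟩
        adj G v u ∧ not (not (X v))
          ≡⟨ cong (adj G v u ∧_) (not-involutive (X v)) ⟩
        adj G v u ∧ X v ∎

    EvenSplit : SimpleGraph n → (Fin n → Bool) → Set
    EvenSplit G T = Σ[ c ∈ (Fin n → Bool) ] IsEven G (λ w → T w ∧ c w) × IsEven G (λ w → T w ∧ not (c w))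

    ∖-updateAt : ∀ (φ : Bool → Bool) (T c : Fin n → Bool) v f →
                 (λ w → T w ∧ φ (updateAt c v f w)) ∖ v ≗ (λ w → (T ∖ v) w ∧ φ (c w))
    ∖-updateAt φ T c v f w with w ≟ v
    ... | yes _  = refl
    ... | no w≢v = cong (λ x → T w ∧ φ x) (updateAt-minimal w v c w≢v)

    evenSplit-localComplement : ∀ G T v → T v ≡ true → oddDegree G T v ≡ true →
                                EvenSplit (localComplement G v) (T ∖ v) → EvenSplit G T
    evenSplit-localComplement G T v Tv odd-v (c′ , even₁ , even₂) =
        c
      , isEven-of-localComplement G v (λ w → T w ∧ c w) (IsEven-cong G′ (sym ∘ side₁) even₁) deg₁
      , isEven-of-localComplement G v (λ w → T w ∧ not (c w)) (IsEven-cong G′ (sym ∘ side₂) even₂) deg₂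
      where
      open ≡-Reasoning
      G′ = localComplement G v
      p q : Bool
      p = oddDegree G (λ w → (T ∖ v) w ∧ c′ w) v
      q = oddDegree G (λ w → (T ∖ v) w ∧ not (c′ w)) v
      -- v joins the side into which it has an even number of neighbours
      c : Fin n → Bool
      c = updateAt c′ v (λ _ → not p)
      side₁ : (λ w → T w ∧ c w) ∖ v ≗ (λ w → (T ∖ v) w ∧ c′ w)
      side₁ = ∖-updateAt (λ x → x) T c′ v (λ _ → not p)
      side₂ : (λ w → T w ∧ not (c w)) ∖ v ≗ (λ w → (T ∖ v) w ∧ not (c′ w))
      side₂ = ∖-updateAt not T c′ v (λ _ → not p)
      c-v : c v ≡ not p
      c-v = updateAt-updates v c′
      p-xor-q : p xor q ≡ true
      p-xor-q = begin
        p xor q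
          ≡⟨ oddDegree-partition G (T ∖ v) c′ v ⟨
        oddDegree G (T ∖ v) v
          ≡⟨ xor-identityʳ _ ⟨
        oddDegree G (T ∖ v) v xor false
          ≡⟨ cong₂ (λ t l → oddDegree G (T ∖ v) v xor (t ∧ l)) Tv (loopless G v) ⟨
        oddDegree G (T ∖ v) v xor (T v ∧ adj G v v)
          ≡⟨ oddDegree-∖ G T v v ⟨
        oddDegree G T v
          ≡⟨ odd-v ⟩
        true ∎
      deg₁ : oddDegree G ((λ w → T w ∧ c w) ∖ v) v ≡ not (T v ∧ c v)
      deg₁ = begin
        oddDegree G ((λ w → T w ∧ c w) ∖ v) v ≡⟨ oddDegree-cong G side₁ v ⟩
        p                                     ≡⟨ not-involutive p ⟨
        not (not p)                           ≡⟨ cong₂ (λ t x → not (t ∧ x)) Tv c-v ⟨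
        not (T v ∧ c v)                       ∎
      deg₂ : oddDegree G ((λ w → T w ∧ not (c w)) ∖ v) v ≡ not (T v ∧ not (c v))
      deg₂ = begin
        oddDegree G ((λ w → T w ∧ not (c w)) ∖ v) v ≡⟨ oddDegree-cong G side₂ v ⟩
        q                                           ≡⟨ xor-cancelʳ (sym (trans (xor-comm q p) p-xor-q)) ⟩
        not p                                       ≡⟨ cong not (not-involutive p) ⟨
        not (not (not p))                           ≡⟨ cong₂ (λ t x → not (t ∧ not x)) Tv c-v ⟨
        not (T v ∧ not (c v))                       ∎

    gallai-acc : ∀ G T → Acc _<_ (size T) → EvenSplit G T
    gallai-acc G T (acc rec) with any? (λ v → T v ≟ᵇ true ×-dec oddDegree G T v ≟ᵇ true)
    ... | yes (v , Tv , odd-v) =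
      evenSplit-localComplement G T v Tv odd-v (gallai-acc (localComplement G v) (T ∖ v) (rec (size-∖-< T v Tv)))
    ... | no ∄odd = (λ _ → true) , IsEven-cong G (λ w → sym (∧-identityʳ (T w))) allEven , noneInside
      where
      allEven : IsEven G T
      allEven u Tu = ¬-not (λ odd-u → ∄odd (u , Tu , odd-u))
      noneInside : IsEven G (λ w → T w ∧ false)
      noneInside u Tu = contradiction (trans (sym (∧-zeroʳ (T u))) Tu) λ ()

    gallai : ∀ G T → EvenSplit G T
    gallai G T = gallai-acc G T (<-wellFounded (size T))

  ∣p∣-parity : ∀ {n} (p : Subset n) → ∃[ q ] ∣ p ∣ ≡ 𝟙 (parity (lookup p)) + q * 2
  ∣p∣-parity []          = 0 , refl
  ∣p∣-parity (false ∷ p) = ∣p∣-parity p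
  ∣p∣-parity (true ∷ p) with parity (lookup p) | ∣p∣-parity p
  ... | false | q , eq = q , cong suc eq
  ... | true  | q , eq = suc q , cong suc eq

  2∣∣p∣ : ∀ {n} (p : Subset n) → parity (lookup p) ≡ false → 2 ∣ ∣ p ∣
  2∣∣p∣ p even with q , eq ← ∣p∣-parity p = divides q (trans eq (cong (λ b → 𝟙 b + q * 2) even))

  lookup-∩-tabulate : ∀ {n} (p : Subset n) f w → lookup (p ∩ tabulate f) w ≡ lookup p w ∧ f w
  lookup-∩-tabulate p f w =
    trans (lookup-zipWith _∧_ w p (tabulate f)) (cong (lookup p w ∧_) (lookup∘tabulate f w))

  lookup-∩-∁-tabulate : ∀ {n} (p : Subset n) f w → lookup (p ∩ ∁ (tabulate f)) w ≡ lookup p w ∧ not (f w)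
  lookup-∩-∁-tabulate p f w = trans (lookup-zipWith _∧_ w p _)
    (cong (lookup p w ∧_) (trans (lookup-map w not (tabulate f)) (cong not (lookup∘tabulate f w))))

  ∣p∩q∣+∣p∩∁q∣≡∣p∣ : ∀ {n} (p q : Subset n) → ∣ p ∩ q ∣ + ∣ p ∩ ∁ q ∣ ≡ ∣ p ∣
  ∣p∩q∣+∣p∩∁q∣≡∣p∣ []          []          = refl
  ∣p∩q∣+∣p∩∁q∣≡∣p∣ (false ∷ p) (_ ∷ q)     = ∣p∩q∣+∣p∩∁q∣≡∣p∣ p q
  ∣p∩q∣+∣p∩∁q∣≡∣p∣ (true ∷ p)  (true ∷ q)  = cong suc (∣p∩q∣+∣p∩∁q∣≡∣p∣ p q)
  ∣p∩q∣+∣p∩∁q∣≡∣p∣ (true ∷ p)  (false ∷ q) = trans (+-suc _ _) (cong suc (∣p∩q∣+∣p∩∁q∣≡∣p∣ p q))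

  IsEven⇒IsEvenInduced : ∀ {n} (G : SimpleGraph n) S → IsEven G (lookup S) → IsEvenInduced G S
  IsEven⇒IsEvenInduced G S even v v∈S =
    2∣∣p∣ (S ∩ tabulate (adj G v)) (trans (parity-cong (lookup-∩-tabulate S (adj G v))) (even v ([]=⇒lookup v∈S)))

  a+b≤2a⊎a+b≤2b : ∀ a b → a + b ≤ 2 * a ⊎ a + b ≤ 2 * b
  a+b≤2a⊎a+b≤2b a b with ≤-total a b
  ... | inj₁ a≤b = inj₂ (subst (a + b ≤_) (cong (b +_) (sym (+-identityʳ b))) (+-monoˡ-≤ b a≤b))
  ... | inj₂ b≤a = inj₁ (subst (a + b ≤_) (cong (a +_) (sym (+-identityʳ a))) (+-monoʳ-≤ a b≤a))

  largeEvenSubset : ∀ {n} (G : SimpleGraph n) (T : Subset n) → ∃[ S ] S ⊆ T × ∣ T ∣ ≤ 2 * ∣ S ∣ × IsEvenInduced G S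
  largeEvenSubset G T = larger (gallai G (lookup T))
    where
    larger : EvenSplit G (lookup T) → ∃[ S ] S ⊆ T × ∣ T ∣ ≤ 2 * ∣ S ∣ × IsEvenInduced G S
    larger (c , even₁ , even₂) with a+b≤2a⊎a+b≤2b ∣ T ∩ tabulate c ∣ ∣ T ∩ ∁ (tabulate c) ∣
    ... | inj₁ big = T ∩ tabulate c , p∩q⊆p T _
                   , subst (_≤ 2 * ∣ T ∩ tabulate c ∣) (∣p∩q∣+∣p∩∁q∣≡∣p∣ T (tabulate c)) big
                   , IsEven⇒IsEvenInduced G _ (IsEven-cong G (sym ∘ lookup-∩-tabulate T c) even₁)
    ... | inj₂ big = T ∩ ∁ (tabulate c) , p∩q⊆p T _
                   , subst (_≤ 2 * ∣ T ∩ ∁ (tabulate c) ∣) (∣p∩q∣+∣p∩∁q∣≡∣p∣ T (tabulate c)) big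
                   , IsEven⇒IsEvenInduced G _ (IsEven-cong G (sym ∘ lookup-∩-∁-tabulate T c) even₂)

module FallingFactorial where

  open import Data.Bool using (true)
  open import Data.Integer as ℤ using (+_)
  import Data.Integer.Properties as ℤ
  open import Data.Nat as ℕ using (ℕ; zero; suc; _+_; _*_; _∸_; _^_; _!; _≤_; z≤n; NonZero)
  open import Data.Nat.Combinatorics using (_C_; nCk≡nPk/k!; nCk≡nC[n∸k]; k>n⇒nCk≡0)
  open import Data.Nat.Combinatorics.Base using (_P′_; _P_)
  open import Data.Nat.DivMod using (m/n*n≤m)
  open import Data.Nat.Properties
    using (≤-refl; ≤-trans; ≤-reflexive; ≰⇒>; ≤⇒≤ᵇ; n≤1+n; m≤m+n; *-assoc; *-identityʳ; *-distribˡ-∸;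
           *-mono-≤; *-monoˡ-≤; *-monoʳ-≤; ∸-monoˡ-≤; ∸-monoʳ-≤; m∸n+n≡m; _!≢0; m*n≢0; m^n≢0; module ≤-Reasoning)
  open import Data.Nat.Tactic.RingSolver using (solve-∀)
  open import Data.Rational as ℚ using (_/_; 1ℚ) renaming (_≤_ to _≤ℚ_)
  import Data.Rational.Properties as ℚ
  open import Data.Rational.Solver using (module +-*-Solver)
  open import Data.Rational.Unnormalised as ℚᵘ using (mkℚᵘ; *≡*) renaming (_≃_ to _≃ᵘ_)
  import Data.Rational.Unnormalised.Properties as ℚᵘ
  open import Relation.Binary.PropositionalEquality
  open import Relation.Nullary using (yes; no)

  open import Defs using (toℚ; fallingQ; binomQ)
  open +-*-Solver using (solve; _:+_; _:*_; _:-_; _:=_)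

  -- a (a − 2) ⋯ (a − 2k + 2), which is 2^k times the falling factorial of a/2 of length k
  doubleFalling : ℕ → ℕ → ℕ
  doubleFalling a zero    = 1
  doubleFalling a (suc k) = (a ∸ 2 * k) * doubleFalling a k

  P′*2^≤doubleFalling : ∀ {m a} k → 2 * m ≤ a → (m P′ k) * 2 ^ k ≤ doubleFalling a k
  P′*2^≤doubleFalling zero    _    = ≤-refl
  P′*2^≤doubleFalling {m} {a} (suc k) 2m≤a = begin
    (m ∸ k) * (m P′ k) * (2 * 2 ^ k)  ≡⟨ rearrange (m ∸ k) (m P′ k) (2 ^ k) ⟩
    (2 * (m ∸ k)) * ((m P′ k) * 2 ^ k)  ≤⟨ *-mono-≤ 2[m∸k]≤a∸2k (P′*2^≤doubleFalling k 2m≤a) ⟩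
    (a ∸ 2 * k) * doubleFalling a k   ∎
    where
    open ≤-Reasoning
    rearrange : ∀ d p e → d * p * (2 * e) ≡ (2 * d) * (p * e)
    rearrange = solve-∀
    2[m∸k]≤a∸2k : 2 * (m ∸ k) ≤ a ∸ 2 * k
    2[m∸k]≤a∸2k = ≤-trans (≤-reflexive (*-distribˡ-∸ 2 m k)) (∸-monoˡ-≤ (2 * k) 2m≤a)

  P≡P′ : ∀ {m k} → k ≤ m → m P k ≡ m P′ k
  P≡P′ {m} {k} k≤m with k ℕ.≤ᵇ m | ≤⇒≤ᵇ k≤m
  ... | true | _ = refl

  C*[!*2^]≤doubleFalling : ∀ {m a} k → 2 * m ≤ a → (m C k) * (k ! * 2 ^ k) ≤ doubleFalling a k
  C*[!*2^]≤doubleFalling {m} {a} k 2m≤a with k ℕ.≤? m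
  ... | no k≰m rewrite k>n⇒nCk≡0 (≰⇒> k≰m) = z≤n
  ... | yes k≤m = begin
    (m C k) * (k ! * 2 ^ k)  ≡⟨ *-assoc (m C k) (k !) (2 ^ k) ⟨
    (m C k) * k ! * 2 ^ k    ≤⟨ *-monoˡ-≤ (2 ^ k) C*!≤P ⟩
    (m P k) * 2 ^ k          ≡⟨ cong (_* 2 ^ k) (P≡P′ k≤m) ⟩
    (m P′ k) * 2 ^ k         ≤⟨ P′*2^≤doubleFalling k 2m≤a ⟩
    doubleFalling a k      ∎
    where
    open ≤-Reasoning
    C*!≤P : (m C k) * k ! ≤ m P k
    C*!≤P = subst (λ c → c * k ! ≤ m P k) (sym (nCk≡nPk/k! k≤m)) (m/n*n≤m (m P k) (k !) {{k !≢0}})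

  -- toℚ a = + a / 1 is normalised by gcd computations, so arithmetic facts about it are
  -- checked in ℚᵘ, where it is simply mkℚᵘ (+ a) 0.
  toℚᵘ-toℚ : ∀ a → ℚ.toℚᵘ (toℚ a) ≃ᵘ mkℚᵘ (+ a) 0
  toℚᵘ-toℚ a = ℚ.toℚᵘ-fromℚᵘ (mkℚᵘ (+ a) 0)

  toℚ-+ : ∀ a b → toℚ (a + b) ≡ toℚ a ℚ.+ toℚ b
  toℚ-+ a b = ℚ.toℚᵘ-injective (begin
    ℚ.toℚᵘ (toℚ (a + b))                  ≈⟨ toℚᵘ-toℚ (a + b) ⟩
    mkℚᵘ (+ (a + b)) 0                    ≈⟨ *≡* (cong (ℤ._* + 1) (trans (ℤ.pos-+ a b)
                                                (sym (cong₂ ℤ._+_ (ℤ.*-identityʳ (+ a)) (ℤ.*-identityʳ (+ b)))))) ⟩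
    mkℚᵘ (+ a) 0 ℚᵘ.+ mkℚᵘ (+ b) 0        ≈⟨ ℚᵘ.+-cong (toℚᵘ-toℚ a) (toℚᵘ-toℚ b) ⟨
    ℚ.toℚᵘ (toℚ a) ℚᵘ.+ ℚ.toℚᵘ (toℚ b)    ≈⟨ ℚ.toℚᵘ-homo-+ (toℚ a) (toℚ b) ⟨
    ℚ.toℚᵘ (toℚ a ℚ.+ toℚ b)              ∎)
    where open ℚᵘ.≃-Reasoning

  toℚ-* : ∀ a b → toℚ (a * b) ≡ toℚ a ℚ.* toℚ b
  toℚ-* a b = ℚ.toℚᵘ-injective (begin
    ℚ.toℚᵘ (toℚ (a * b))                  ≈⟨ toℚᵘ-toℚ (a * b) ⟩
    mkℚᵘ (+ (a * b)) 0                    ≈⟨ *≡* (cong (ℤ._* + 1) (ℤ.pos-* a b)) ⟩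
    mkℚᵘ (+ a) 0 ℚᵘ.* mkℚᵘ (+ b) 0        ≈⟨ ℚᵘ.*-cong (toℚᵘ-toℚ a) (toℚᵘ-toℚ b) ⟨
    ℚ.toℚᵘ (toℚ a) ℚᵘ.* ℚ.toℚᵘ (toℚ b)    ≈⟨ ℚ.toℚᵘ-homo-* (toℚ a) (toℚ b) ⟨
    ℚ.toℚᵘ (toℚ a ℚ.* toℚ b)              ∎)
    where open ℚᵘ.≃-Reasoning

  toℚ-mono-≤ : ∀ {a b} → a ≤ b → toℚ a ≤ℚ toℚ b
  toℚ-mono-≤ {a} {b} a≤b = ℚ.toℚᵘ-cancel-≤ (begin
    ℚ.toℚᵘ (toℚ a)  ≃⟨ toℚᵘ-toℚ a ⟩
    mkℚᵘ (+ a) 0    ≤⟨ ℚᵘ.*≤* (ℤ.*-monoʳ-≤-nonNeg (+ 1) (ℤ.+≤+ a≤b)) ⟩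
    mkℚᵘ (+ b) 0    ≃⟨ toℚᵘ-toℚ b ⟨
    ℚ.toℚᵘ (toℚ b)  ∎)
    where open ℚᵘ.≤-Reasoning

  +a/d*d≡a : ∀ a d .{{_ : NonZero d}} → (+ a / d) ℚ.* toℚ d ≡ toℚ a
  +a/d*d≡a a d@(suc d-1) = ℚ.toℚᵘ-injective (begin
    ℚ.toℚᵘ ((+ a / d) ℚ.* toℚ d)              ≈⟨ ℚ.toℚᵘ-homo-* (+ a / d) (toℚ d) ⟩
    ℚ.toℚᵘ (+ a / d) ℚᵘ.* ℚ.toℚᵘ (toℚ d)       ≈⟨ ℚᵘ.*-cong (ℚ.toℚᵘ-fromℚᵘ (mkℚᵘ (+ a) d-1)) (toℚᵘ-toℚ d) ⟩
    mkℚᵘ (+ a) d-1 ℚᵘ.* mkℚᵘ (+ d) 0           ≈⟨ *≡* (trans (ℤ.*-identityʳ (+ a ℤ.* + d))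
                                                         (cong (λ e → + a ℤ.* + e) (sym (*-identityʳ d)))) ⟩
    mkℚᵘ (+ a) 0                              ≈⟨ toℚᵘ-toℚ a ⟨
    ℚ.toℚᵘ (toℚ a)                            ∎)
    where open ℚᵘ.≃-Reasoning


  toℚ-∸ : ∀ {a b} → b ≤ a → toℚ (a ∸ b) ≡ toℚ a ℚ.- toℚ b
  toℚ-∸ {a} {b} b≤a = begin
    toℚ (a ∸ b)                        ≡⟨ solve 2 (λ x y → x := (x :+ y) :- y) refl (toℚ (a ∸ b)) (toℚ b) ⟩
    (toℚ (a ∸ b) ℚ.+ toℚ b) ℚ.- toℚ b  ≡⟨ cong (ℚ._- toℚ b) (toℚ-+ (a ∸ b) b) ⟨
    toℚ (a ∸ b + b) ℚ.- toℚ b          ≡⟨ cong (λ c → toℚ c ℚ.- toℚ b) (m∸n+n≡m b≤a) ⟩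
    toℚ a ℚ.- toℚ b                    ∎
    where open ≡-Reasoning

  fallingQ*2^≡doubleFalling : ∀ x {a} k → x ℚ.* toℚ 2 ≡ toℚ a → 2 * k ≤ a →
                              fallingQ x k ℚ.* toℚ (2 ^ k) ≡ toℚ (doubleFalling a k)
  fallingQ*2^≡doubleFalling x zero    _    _    = ℚ.*-identityˡ 1ℚ
  fallingQ*2^≡doubleFalling x {a} (suc k) 2x≡a 2k+2≤a = begin
    fallingQ x k ℚ.* (x ℚ.- toℚ k) ℚ.* toℚ (2 * 2 ^ k)
      ≡⟨ cong (fallingQ x k ℚ.* (x ℚ.- toℚ k) ℚ.*_) (toℚ-* 2 (2 ^ k)) ⟩
    fallingQ x k ℚ.* (x ℚ.- toℚ k) ℚ.* (toℚ 2 ℚ.* toℚ (2 ^ k))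
      ≡⟨ solve 4 (λ f y t e → (f :* y) :* (t :* e) := (y :* t) :* (f :* e)) refl
                 (fallingQ x k) (x ℚ.- toℚ k) (toℚ 2) (toℚ (2 ^ k)) ⟩
    (x ℚ.- toℚ k) ℚ.* toℚ 2 ℚ.* (fallingQ x k ℚ.* toℚ (2 ^ k))
      ≡⟨ cong₂ ℚ._*_ last-factor (fallingQ*2^≡doubleFalling x k 2x≡a 2k≤a) ⟩
    toℚ (a ∸ 2 * k) ℚ.* toℚ (doubleFalling a k)
      ≡⟨ toℚ-* (a ∸ 2 * k) (doubleFalling a k) ⟨
    toℚ ((a ∸ 2 * k) * doubleFalling a k) ∎
    where
    open ≡-Reasoning
    2k≤a : 2 * k ≤ a
    2k≤a = ≤-trans (*-monoʳ-≤ 2 (n≤1+n k)) 2k+2≤a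
    last-factor : (x ℚ.- toℚ k) ℚ.* toℚ 2 ≡ toℚ (a ∸ 2 * k)
    last-factor = begin
      (x ℚ.- toℚ k) ℚ.* toℚ 2
        ≡⟨ solve 3 (λ y i t → (y :- i) :* t := y :* t :- t :* i) refl x (toℚ k) (toℚ 2) ⟩
      x ℚ.* toℚ 2 ℚ.- toℚ 2 ℚ.* toℚ k
        ≡⟨ cong₂ ℚ._-_ 2x≡a (sym (toℚ-* 2 k)) ⟩
      toℚ a ℚ.- toℚ (2 * k)
        ≡⟨ toℚ-∸ 2k≤a ⟨
      toℚ (a ∸ 2 * k) ∎

  binomQ*!≡fallingQ : ∀ x k → binomQ x k ℚ.* toℚ (k !) ≡ fallingQ x k
  binomQ*!≡fallingQ x k = begin
    fallingQ x k ℚ.* (+ 1 / k !) ℚ.* toℚ (k !)    ≡⟨ ℚ.*-assoc (fallingQ x k) (+ 1 / k !) (toℚ (k !)) ⟩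
    fallingQ x k ℚ.* ((+ 1 / k !) ℚ.* toℚ (k !))  ≡⟨ cong (fallingQ x k ℚ.*_) (+a/d*d≡a 1 (k !)) ⟩
    fallingQ x k ℚ.* 1ℚ                           ≡⟨ ℚ.*-identityʳ (fallingQ x k) ⟩
    fallingQ x k                                  ∎
    where
    open ≡-Reasoning
    instance _ = k !≢0

  toℚ≤toℚ*binomQ : ∀ {m c a} k x → x ℚ.* toℚ 2 ≡ toℚ a → 2 * k ≤ a →
                    m * (k ! * 2 ^ k) ≤ c * doubleFalling a k → toℚ m ≤ℚ toℚ c ℚ.* binomQ x k
  toℚ≤toℚ*binomQ {m} {c} {a} k x 2x≡a 2k≤a bound = ℚ.*-cancelʳ-≤-pos (toℚ e) (begin
    toℚ m ℚ.* toℚ e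
      ≡⟨ toℚ-* m e ⟨
    toℚ (m * e)
      ≤⟨ toℚ-mono-≤ bound ⟩
    toℚ (c * doubleFalling a k)
      ≡⟨ toℚ-* c (doubleFalling a k) ⟩
    toℚ c ℚ.* toℚ (doubleFalling a k)
      ≡⟨ cong (toℚ c ℚ.*_) (fallingQ*2^≡doubleFalling x k 2x≡a 2k≤a) ⟨
    toℚ c ℚ.* (fallingQ x k ℚ.* toℚ (2 ^ k))
      ≡⟨ cong (λ f → toℚ c ℚ.* (f ℚ.* toℚ (2 ^ k))) (binomQ*!≡fallingQ x k) ⟨
    toℚ c ℚ.* (binomQ x k ℚ.* toℚ (k !) ℚ.* toℚ (2 ^ k))
      ≡⟨ solve 4 (λ C B K T → C :* (B :* K :* T) := C :* B :* (K :* T)) refl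
                 (toℚ c) (binomQ x k) (toℚ (k !)) (toℚ (2 ^ k)) ⟩
    toℚ c ℚ.* binomQ x k ℚ.* (toℚ (k !) ℚ.* toℚ (2 ^ k))
      ≡⟨ cong (toℚ c ℚ.* binomQ x k ℚ.*_) (toℚ-* (k !) (2 ^ k)) ⟨
    toℚ c ℚ.* binomQ x k ℚ.* toℚ e ∎)
    where
    open ℚ.≤-Reasoning
    e = k ! * 2 ^ k
    instance
      e≢0 : NonZero e
      e≢0 = m*n≢0 (k !) (2 ^ k) {{k !≢0}} {{m^n≢0 2 k}}
      e>0 : ℚ.Positive (toℚ e)
      e>0 = ℚ.normalize-pos e 1

  [n-t/2]*2≡2n∸t : ∀ {n t} → t ≤ 2 * n → (toℚ n ℚ.- + t / 2) ℚ.* toℚ 2 ≡ toℚ (2 * n ∸ t)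
  [n-t/2]*2≡2n∸t {n} {t} t≤2n = begin
    (toℚ n ℚ.- + t / 2) ℚ.* toℚ 2
      ≡⟨ solve 3 (λ N h T → (N :- h) :* T := T :* N :- h :* T) refl (toℚ n) (+ t / 2) (toℚ 2) ⟩
    toℚ 2 ℚ.* toℚ n ℚ.- (+ t / 2) ℚ.* toℚ 2
      ≡⟨ cong₂ ℚ._-_ (toℚ-* 2 n) (sym (+a/d*d≡a t 2)) ⟨
    toℚ (2 * n) ℚ.- toℚ t
      ≡⟨ toℚ-∸ t≤2n ⟨
    toℚ (2 * n ∸ t) ∎
    where open ≡-Reasoning

  C≤toℚ*binomQ : ∀ {n t c} → t ≤ n →
    (n C t) * ((n ∸ t) ! * 2 ^ (n ∸ t)) ≤ c * doubleFalling (2 * n ∸ t) (n ∸ t) →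
    toℚ (n C (n ∸ t)) ≤ℚ toℚ c ℚ.* binomQ (toℚ n ℚ.- + t / 2) (n ∸ t)
  C≤toℚ*binomQ {n} {t} {c} t≤n bound =
    subst (_≤ℚ toℚ c ℚ.* binomQ (toℚ n ℚ.- + t / 2) (n ∸ t)) (cong toℚ (nCk≡nC[n∸k] t≤n))
      (toℚ≤toℚ*binomQ {n C t} {c} (n ∸ t) (toℚ n ℚ.- + t / 2) ([n-t/2]*2≡2n∸t {n} t≤2n) 2[n∸t]≤2n∸t bound)
    where
    t≤2n : t ≤ 2 * n
    t≤2n = ≤-trans t≤n (m≤m+n n (n + 0))
    2[n∸t]≤2n∸t : 2 * (n ∸ t) ≤ 2 * n ∸ t
    2[n∸t]≤2n∸t = ≤-trans (≤-reflexive (*-distribˡ-∸ 2 n t)) (∸-monoʳ-≤ (2 * n) (m≤m+n t (t + 0)))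

module Counting where

  open import Data.Bool using (true; false; _∧_)
  open import Data.Fin.Subset using (Subset; ∣_∣; _⊆_; ⊥)
  open import Data.Fin.Subset.Properties using (_⊆?_; p⊆q⇒∣p∣≤∣q∣; ∣p∣≤n; ⊥⊆; ∣⊥∣≡0)
  open import Data.List using (List; []; _∷_; map; _++_; length; filter)
  open import Data.List.Membership.Propositional using (_∈_)
  open import Data.List.Membership.Propositional.Properties using (∈-map⁺; ∈-++⁺ˡ; ∈-++⁺ʳ)
  open import Data.List.Relation.Unary.Any using (here; there)
  open import Data.Nat using (ℕ; zero; suc; _+_; _*_; _∸_; _^_; _!; _≤_; _≤?_; z≤n; s≤s; _≟_)
  open import Data.Nat.Combinatorics using (_C_; nCk≡nC[n∸k]; nCk+nC[k+1]≡[n+1]C[k+1])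
  open import Data.Nat.Properties
    using (≤-trans; ≤-reflexive; <⇒≱; m≤m+n; m≤n+m; +-assoc; +-suc; +-identityʳ; +-mono-≤; *-assoc; *-zeroʳ;
           *-distribˡ-+; *-distribʳ-+; *-distribˡ-∸; *-monoˡ-≤; *-monoʳ-≤; ∸-monoˡ-≤; ∸-monoʳ-≤; ∸-+-assoc;
           +-∸-assoc; m+[n∸m]≡n; module ≤-Reasoning)
  open import Data.Nat.Tactic.RingSolver using (solve-∀)
  open import Data.Product using (∃-syntax; _×_; _,_)
  open import Data.Vec using ([]; _∷_)
  open import Relation.Binary.PropositionalEquality
  open import Relation.Nullary using (Dec; does; yes; no)
  open import Relation.Nullary.Decidable using (_×-dec_; dec-true; dec-false)
  open import Relation.Unary using (Pred; Decidable)

  open import Defs hiding (sym)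
  open Gallai using (𝟙; largeEvenSubset)
  open FallingFactorial using (doubleFalling; C*[!*2^]≤doubleFalling)

  ∑ : ∀ {A : Set} → List A → (A → ℕ) → ℕ
  ∑ []       f = 0
  ∑ (x ∷ xs) f = f x + ∑ xs f

  module _ {A : Set} where

    ∑-cong : ∀ (xs : List A) {f g} → (∀ x → f x ≡ g x) → ∑ xs f ≡ ∑ xs g
    ∑-cong []       f≗g = refl
    ∑-cong (x ∷ xs) f≗g = cong₂ _+_ (f≗g x) (∑-cong xs f≗g)

    ∑-mono-≤ : ∀ (xs : List A) {f g} → (∀ x → f x ≤ g x) → ∑ xs f ≤ ∑ xs g
    ∑-mono-≤ []       f≤g = z≤n
    ∑-mono-≤ (x ∷ xs) f≤g = +-mono-≤ (f≤g x) (∑-mono-≤ xs f≤g)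

    ∑-zero : ∀ (xs : List A) {f} → (∀ x → f x ≡ 0) → ∑ xs f ≡ 0
    ∑-zero []       f≡0 = refl
    ∑-zero (x ∷ xs) f≡0 = cong₂ _+_ (f≡0 x) (∑-zero xs f≡0)

    ∑-distrib-+ : ∀ (xs : List A) f g → ∑ xs (λ x → f x + g x) ≡ ∑ xs f + ∑ xs g
    ∑-distrib-+ []       f g = refl
    ∑-distrib-+ (x ∷ xs) f g = trans (cong (f x + g x +_) (∑-distrib-+ xs f g)) (interchange (f x) (g x) _ _)
      where
      interchange : ∀ a b c d → a + b + (c + d) ≡ a + c + (b + d)
      interchange = solve-∀

    *-distribˡ-∑ : ∀ c (xs : List A) f → c * ∑ xs f ≡ ∑ xs (λ x → c * f x)
    *-distribˡ-∑ c []       f = *-zeroʳ c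
    *-distribˡ-∑ c (x ∷ xs) f = trans (*-distribˡ-+ c (f x) _) (cong (c * f x +_) (*-distribˡ-∑ c xs f))

    *-distribʳ-∑ : ∀ c (xs : List A) f → ∑ xs f * c ≡ ∑ xs (λ x → f x * c)
    *-distribʳ-∑ c []       f = refl
    *-distribʳ-∑ c (x ∷ xs) f = trans (*-distribʳ-+ c (f x) _) (cong (f x * c +_) (*-distribʳ-∑ c xs f))

    ∑-++ : ∀ (xs ys : List A) f → ∑ (xs ++ ys) f ≡ ∑ xs f + ∑ ys f
    ∑-++ []       ys f = refl
    ∑-++ (x ∷ xs) ys f = trans (cong (f x +_) (∑-++ xs ys f)) (sym (+-assoc (f x) _ _))

    ∈⇒≤∑ : ∀ {xs : List A} {x} f → x ∈ xs → f x ≤ ∑ xs f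
    ∈⇒≤∑ f (here refl)  = m≤m+n _ _
    ∈⇒≤∑ f (there x∈xs) = ≤-trans (∈⇒≤∑ f x∈xs) (m≤n+m _ _)

    length-filter≡∑ : ∀ {p} {P : Pred A p} (P? : Decidable P) xs →
                      length (filter P? xs) ≡ ∑ xs (λ x → 𝟙 (does (P? x)))
    length-filter≡∑ P? []       = refl
    length-filter≡∑ P? (x ∷ xs) with does (P? x)
    ... | true  = cong suc (length-filter≡∑ P? xs)
    ... | false = length-filter≡∑ P? xs

  ∑-map : ∀ {A B : Set} (g : A → B) (xs : List A) f → ∑ (map g xs) f ≡ ∑ xs (λ x → f (g x))
  ∑-map g []       f = refl
  ∑-map g (x ∷ xs) f = cong (f (g x) +_) (∑-map g xs f)

  ∑-comm : ∀ {A B : Set} (xs : List A) (ys : List B) (f : A → B → ℕ) →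
           ∑ xs (λ x → ∑ ys (f x)) ≡ ∑ ys (λ y → ∑ xs (λ x → f x y))
  ∑-comm []       ys f = sym (∑-zero ys (λ _ → refl))
  ∑-comm (x ∷ xs) ys f = trans (cong (∑ ys (f x) +_) (∑-comm xs ys f))
                               (sym (∑-distrib-+ ys (f x) (λ y → ∑ xs (λ x′ → f x′ y))))

  ∑-allSubsets-suc : ∀ n f →
    ∑ (allSubsets (suc n)) f ≡ ∑ (allSubsets n) (λ T → f (true ∷ T)) + ∑ (allSubsets n) (λ T → f (false ∷ T))
  ∑-allSubsets-suc n f = trans (∑-++ (map (true ∷_) (allSubsets n)) _ f)
    (cong₂ _+_ (∑-map (true ∷_) (allSubsets n) f) (∑-map (false ∷_) (allSubsets n) f))

  ∈-allSubsets : ∀ {n} (S : Subset n) → S ∈ allSubsets n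
  ∈-allSubsets []          = here refl
  ∈-allSubsets (true ∷ S)  = ∈-++⁺ˡ (∈-map⁺ (true ∷_) (∈-allSubsets S))
  ∈-allSubsets (false ∷ S) = ∈-++⁺ʳ _ (∈-map⁺ (false ∷_) (∈-allSubsets S))

  supersetsOfSize : ∀ {n} → Subset n → ℕ → ℕ
  supersetsOfSize {n} S m = ∑ (allSubsets n) (λ T → 𝟙 (does (S ⊆? T ×-dec ∣ T ∣ ≟ m)))

  supersetsOfSize-true∷ : ∀ {n} (S : Subset n) m → supersetsOfSize (true ∷ S) (suc m) ≡ supersetsOfSize S m
  supersetsOfSize-true∷ {n} S m =
    trans (∑-allSubsets-suc n _)
          (trans (cong (supersetsOfSize S m +_) (∑-zero (allSubsets n) (λ _ → refl))) (+-identityʳ _))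

  supersetsOfSize-false∷ : ∀ {n} (S : Subset n) m →
                           supersetsOfSize (false ∷ S) (suc m) ≡ supersetsOfSize S m + supersetsOfSize S (suc m)
  supersetsOfSize-false∷ {n} S m = ∑-allSubsets-suc n _

  supersetsOfSize≡C : ∀ {n} (S : Subset n) j → supersetsOfSize S (∣ S ∣ + j) ≡ (n ∸ ∣ S ∣) C j
  supersetsOfSize≡C []          zero    = refl
  supersetsOfSize≡C []          (suc j) = refl
  supersetsOfSize≡C (true ∷ S)  j       = trans (supersetsOfSize-true∷ S (∣ S ∣ + j)) (supersetsOfSize≡C S j)
  supersetsOfSize≡C {suc n} (false ∷ S) zero =
    trans (∑-allSubsets-suc n _) (cong₂ _+_ (∑-zero (allSubsets n) too-small) (supersetsOfSize≡C S 0))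
    where
    too-small : ∀ T → 𝟙 (does (S ⊆? T ×-dec suc ∣ T ∣ ≟ ∣ S ∣ + 0)) ≡ 0
    too-small T with S ⊆? T
    ... | no  _   = refl
    ... | yes S⊆T = cong (λ b → 𝟙 (true ∧ b)) (dec-false (suc ∣ T ∣ ≟ ∣ S ∣ + 0) λ eq →
                      <⇒≱ (s≤s (p⊆q⇒∣p∣≤∣q∣ S⊆T)) (≤-reflexive (trans eq (+-identityʳ ∣ S ∣))))
  supersetsOfSize≡C {suc n} (false ∷ S) (suc j) = begin
    supersetsOfSize (false ∷ S) (∣ S ∣ + suc j)
      ≡⟨ cong (supersetsOfSize (false ∷ S)) (+-suc ∣ S ∣ j) ⟩
    supersetsOfSize (false ∷ S) (suc (∣ S ∣ + j))
      ≡⟨ supersetsOfSize-false∷ S (∣ S ∣ + j) ⟩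
    supersetsOfSize S (∣ S ∣ + j) + supersetsOfSize S (suc (∣ S ∣ + j))
      ≡⟨ cong (λ m → supersetsOfSize S (∣ S ∣ + j) + supersetsOfSize S m) (+-suc ∣ S ∣ j) ⟨
    supersetsOfSize S (∣ S ∣ + j) + supersetsOfSize S (∣ S ∣ + suc j)
      ≡⟨ cong₂ _+_ (supersetsOfSize≡C S j) (supersetsOfSize≡C S (suc j)) ⟩
    (n ∸ ∣ S ∣) C j + (n ∸ ∣ S ∣) C suc j
      ≡⟨ nCk+nC[k+1]≡[n+1]C[k+1] (n ∸ ∣ S ∣) j ⟩
    suc (n ∸ ∣ S ∣) C suc j
      ≡⟨ cong (_C suc j) (+-∸-assoc 1 (∣p∣≤n S)) ⟨
    (suc n ∸ ∣ S ∣) C suc j ∎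
    where open ≡-Reasoning

  𝟙-*-mono-≤ : ∀ {p} {P : Set p} (P? : Dec P) {a b} → (P → a ≤ b) → 𝟙 (does P?) * a ≤ 𝟙 (does P?) * b
  𝟙-*-mono-≤ (yes p) a≤b = *-monoʳ-≤ 1 (a≤b p)
  𝟙-*-mono-≤ (no _)  _   = z≤n

  double-counting : ∀ {A B : Set} {P : A → Set} {Q : B → Set} {R : A → B → Set}
    (P? : Decidable P) (Q? : Decidable Q) (R? : ∀ x y → Dec (R x y)) (xs : List A) (ys : List B) {K F : ℕ} →
    (∀ y → Q y → ∃[ x ] x ∈ xs × P x × R x y) →
    (∀ x → P x → ∑ ys (λ y → 𝟙 (does (R? x y ×-dec Q? y))) * K ≤ F) →
    length (filter Q? ys) * K ≤ length (filter P? xs) * F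
  double-counting {A} {B} {Q = Q} P? Q? R? xs ys {K} {F} cover bound = begin
    length (filter Q? ys) * K                        ≡⟨ cong (_* K) (length-filter≡∑ Q? ys) ⟩
    ∑ ys (λ y → 𝟙 (does (Q? y))) * K                 ≤⟨ *-monoˡ-≤ K (∑-mono-≤ ys covered) ⟩
    ∑ ys (λ y → ∑ xs (λ x → w x y)) * K              ≡⟨ cong (_* K) (∑-comm ys xs (λ y x → w x y)) ⟩
    ∑ xs (λ x → ∑ ys (w x)) * K                      ≡⟨ *-distribʳ-∑ K xs (λ x → ∑ ys (w x)) ⟩
    ∑ xs (λ x → ∑ ys (w x) * K)                      ≤⟨ ∑-mono-≤ xs bounded ⟩
    ∑ xs (λ x → 𝟙 (does (P? x)) * F)                 ≡⟨ *-distribʳ-∑ F xs (λ x → 𝟙 (does (P? x))) ⟨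
    ∑ xs (λ x → 𝟙 (does (P? x))) * F                 ≡⟨ cong (_* F) (length-filter≡∑ P? xs) ⟨
    length (filter P? xs) * F                        ∎
    where
    open ≤-Reasoning
    r : A → B → ℕ
    r x y = 𝟙 (does (R? x y ×-dec Q? y))
    w : A → B → ℕ
    w x y = 𝟙 (does (P? x)) * r x y
    covered : ∀ y → 𝟙 (does (Q? y)) ≤ ∑ xs (λ x → w x y)
    covered y = covered-by (Q? y)
      where
      covered-by : (Q?y : Dec (Q y)) → 𝟙 (does Q?y) ≤ ∑ xs (λ x → w x y)
      covered-by (no  _)  = z≤n
      covered-by (yes Qy) with x , x∈xs , Px , Rxy ← cover y Qy =
        ≤-trans (≤-reflexive (sym (cong₂ (λ p q → 𝟙 p * 𝟙 q) (dec-true (P? x) Px)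
                                                             (dec-true (R? x y ×-dec Q? y) (Rxy , Qy)))))
                (∈⇒≤∑ (λ x → w x y) x∈xs)
    bounded : ∀ x → ∑ ys (w x) * K ≤ 𝟙 (does (P? x)) * F
    bounded x = begin
      ∑ ys (w x) * K                       ≡⟨ cong (_* K) (*-distribˡ-∑ (𝟙 (does (P? x))) ys (r x)) ⟨
      𝟙 (does (P? x)) * ∑ ys (r x) * K     ≡⟨ *-assoc (𝟙 (does (P? x))) (∑ ys (r x)) K ⟩
      𝟙 (does (P? x)) * (∑ ys (r x) * K)   ≤⟨ 𝟙-*-mono-≤ (P? x) (bound x) ⟩
      𝟙 (does (P? x)) * F                  ∎

  -- the decision procedure inside countEvenInRange, so that the count is length-filter by definition
  evenInRange? : ∀ {n} (G : SimpleGraph n) t → Decidable (λ S → InRange t S × IsEvenInduced G S)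
  evenInRange? G t S = (t ≤? 2 * ∣ S ∣ ×-dec ∣ S ∣ ≤? t) ×-dec isEvenInduced? G S

  length-filter-∣∣≡C : ∀ n t → length (filter (λ T → ∣ T ∣ ≟ t) (allSubsets n)) ≡ n C t
  length-filter-∣∣≡C n t = begin
    length (filter (λ T → ∣ T ∣ ≟ t) (allSubsets n)) ≡⟨ length-filter≡∑ (λ T → ∣ T ∣ ≟ t) (allSubsets n) ⟩
    ∑ (allSubsets n) (λ T → 𝟙 (does (∣ T ∣ ≟ t)))    ≡⟨ ∑-cong (allSubsets n) from-⊥ ⟩
    supersetsOfSize (⊥ {n}) (∣ ⊥ {n} ∣ + t)          ≡⟨ supersetsOfSize≡C (⊥ {n}) t ⟩
    (n ∸ ∣ ⊥ {n} ∣) C t                              ≡⟨ cong (λ s → (n ∸ s) C t) (∣⊥∣≡0 n) ⟩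
    n C t                                            ∎
    where
    open ≡-Reasoning
    from-⊥ : ∀ T → 𝟙 (does (∣ T ∣ ≟ t)) ≡ 𝟙 (does (⊥ ⊆? T ×-dec ∣ T ∣ ≟ ∣ ⊥ {n} ∣ + t))
    from-⊥ T = sym (cong₂ (λ b s → 𝟙 (b ∧ does (∣ T ∣ ≟ s + t))) (dec-true (⊥ ⊆? T) ⊥⊆) (∣⊥∣≡0 n))

  C*[!*2^]≤countEvenInRange*doubleFalling : ∀ {n} (G : SimpleGraph n) {t} → t ≤ n →
    (n C t) * ((n ∸ t) ! * 2 ^ (n ∸ t)) ≤ countEvenInRange G t * doubleFalling (2 * n ∸ t) (n ∸ t)
  C*[!*2^]≤countEvenInRange*doubleFalling {n} G {t} t≤n =
    subst (λ c → c * ((n ∸ t) ! * 2 ^ (n ∸ t)) ≤ countEvenInRange G t * doubleFalling (2 * n ∸ t) (n ∸ t))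
          (length-filter-∣∣≡C n t)
      (double-counting (evenInRange? G t) (λ T → ∣ T ∣ ≟ t) _⊆?_ (allSubsets n) (allSubsets n) cover bound)
    where
    k = n ∸ t
    cover : ∀ T → ∣ T ∣ ≡ t → ∃[ S ] S ∈ allSubsets n × (InRange t S × IsEvenInduced G S) × S ⊆ T
    cover T ∣T∣≡t with S , S⊆T , T≤2S , even ← largeEvenSubset G T =
      S , ∈-allSubsets S
        , ((subst (_≤ 2 * ∣ S ∣) ∣T∣≡t T≤2S , subst (∣ S ∣ ≤_) ∣T∣≡t (p⊆q⇒∣p∣≤∣q∣ S⊆T)) , even) , S⊆T
    bound : ∀ S → InRange t S × IsEvenInduced G S →
            supersetsOfSize S t * (k ! * 2 ^ k) ≤ doubleFalling (2 * n ∸ t) k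
    bound S ((t≤2s , s≤t) , _) = begin
      supersetsOfSize S t * (k ! * 2 ^ k)
        ≡⟨ cong (_* (k ! * 2 ^ k)) supersets≡C ⟩
      ((n ∸ ∣ S ∣) C k) * (k ! * 2 ^ k)
        ≤⟨ C*[!*2^]≤doubleFalling k 2[n∸s]≤2n∸t ⟩
      doubleFalling (2 * n ∸ t) k ∎
      where
      open ≤-Reasoning
      s = ∣ S ∣
      [n∸s]∸[t∸s]≡k : (n ∸ s) ∸ (t ∸ s) ≡ k
      [n∸s]∸[t∸s]≡k = trans (∸-+-assoc n s (t ∸ s)) (cong (n ∸_) (m+[n∸m]≡n s≤t))
      supersets≡C : supersetsOfSize S t ≡ (n ∸ s) C k
      supersets≡C = begin-equality
        supersetsOfSize S t
          ≡⟨ cong (supersetsOfSize S) (m+[n∸m]≡n s≤t) ⟨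
        supersetsOfSize S (s + (t ∸ s))
          ≡⟨ supersetsOfSize≡C S (t ∸ s) ⟩
        (n ∸ s) C (t ∸ s)
          ≡⟨ nCk≡nC[n∸k] (∸-monoˡ-≤ s t≤n) ⟩
        (n ∸ s) C ((n ∸ s) ∸ (t ∸ s))
          ≡⟨ cong ((n ∸ s) C_) [n∸s]∸[t∸s]≡k ⟩
        (n ∸ s) C k ∎
      2[n∸s]≤2n∸t : 2 * (n ∸ s) ≤ 2 * n ∸ t
      2[n∸s]≤2n∸t = ≤-trans (≤-reflexive (*-distribˡ-∸ 2 n s)) (∸-monoʳ-≤ (2 * n) t≤2s)

open import Defs
open import Data.Nat using (ℕ; _≤_; _∸_)
open import Data.Nat.Combinatorics using (_C_)
open import Data.Rational using (_/_; _*_; _-_) renaming (_≤_ to _≤ℚ_)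
open import Data.Integer using (+_)

theorem3p1 : (θ : ℕ → ℕ) (n : ℕ) → 1 ≤ θ n → θ n ≤ n → (G : SimpleGraph n) →
    toℚ (n C (n ∸ θ n)) ≤ℚ toℚ (countEvenInRange G (θ n)) * binomQ (toℚ n - (+ θ n / 2)) (n ∸ θ n)
theorem3p1 θ n _ θ≤n G =
  FallingFactorial.C≤toℚ*binomQ {c = countEvenInRange G (θ n)} θ≤n
    (Counting.C*[!*2^]≤countEvenInRange*doubleFalling G θ≤n)
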